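{- Let $(Z,\bowtie)$ be an apartness space, let $z\in Z$ have a countable base $(V_n)_{n\ge1}$ of neighbourhoods in the apartness topology, and let $(z_n)_{n\in\mathfrak{D}}$ be a net in $Z$ that converges to $z$ in the apartness topology. Then there is a countable subnet $(z_{n_k})_{k\ge1}$ of $(z_n)_{n\in\mathfrak{D}}$ that converges to $z$.
   Context: Work in Bishop-style constructive mathematics (intuitionistic logic). An apartness space $(Z,\bowtie)$ is a set with an inequality and a symmetric relation $\bowtie$ between subsets satisfying the constructive apartness axioms; writing $-S=\{x:\{x\}\bowtie S\}$, the apartness topology is the topology with base the sets $-S$. A countable base of neighbourhoods of $z$ is a sequence $(V_n)$ of neighbourhoods of $z$ such that every neighbourhood of $z$ contains some $V_n$. A net $(z_n)_{n\in\mathfrak{D}}$ (indexed by a directed preordered set $(\mathfrak{D},\succcurlyeq)$) converges to $z$ if for every neighbourhood $V$ of $z$ there is $N\in\mathfrak{D}$ with $z_n\in V$ for all $n\succcurlyeq N$. A countable subnet is a subnet indexed by the positive integers, i.e. of the form $(z_{n_k})_{k\ge1}$ with $n_k\in\mathfrak{D}$ and $n_{k+1}\succcurlyeq n_k$. -}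

module Defs where

open import Level using (0ℓ)
open import Data.Nat using (ℕ; _≥_)
open import Data.Nat.Properties using (≤-refl; ≤-trans; m≤m⊔n; m≤n⊔m)
open import Data.Nat using (_⊔_)
open import Data.Product using (Σ; _×_; _,_; ∃)
open import Data.Sum using (_⊎_)
open import Data.Empty using (⊥)
open import Data.Unit using (⊤)
open import Relation.Nullary using (¬_)
open import Relation.Binary using (IsEquivalence)

Subset : Set → Set₁
Subset Z = Z → Set

-- An apartness space (Bishop-style): a set with equality _≈_, an
-- inequality _≠_, and a symmetric set-set apartness _⋈_ satisfying the
-- constructive apartness axioms (Bridges–Vîță).
record ApartnessSpace : Set₁ where
  infix 4 _≈_ _≠_ _⋈_
  field
    Carrier : Set
    _≈_     : Carrier → Carrier → Set
    ≈-equiv : IsEquivalence _≈_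
    _≠_     : Carrier → Carrier → Set
    ≠-irr   : ∀ {x y} → x ≠ y → ¬ (x ≈ y)
    ≠-sym   : ∀ {x y} → x ≠ y → y ≠ x
    _⋈_     : Subset Carrier → Subset Carrier → Set

  ｛_｝ : Carrier → Subset Carrier
  ｛ x ｝ = λ y → y ≈ x

  _∪_ : Subset Carrier → Subset Carrier → Subset Carrier
  (A ∪ B) x = A x ⊎ B x

  ∅ : Subset Carrier
  ∅ _ = ⊥

  Whole : Subset Carrier
  Whole _ = ⊤

  -_ : Subset Carrier → Subset Carrier
  (- S) x = ｛ x ｝ ⋈ S

  field
    ⋈-sym : ∀ {A B} → A ⋈ B → B ⋈ A
    B1 : Whole ⋈ ∅
    B2 : ∀ {A B} → A ⋈ B → ∀ a b → A a → B b → a ≠ b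
    B3 : ∀ {A B C} → (A ⋈ (B ∪ C) → (A ⋈ B) × (A ⋈ C))
                   × ((A ⋈ B) × (A ⋈ C) → A ⋈ (B ∪ C))
    B4 : ∀ {A x} → (- A) x → ∀ y → (x ≠ y) ⊎ (- A) y

  -- V is a neighbourhood of z in the apartness topology (the topology
  -- with base the sets -S): V contains a basic open set -S containing z.
  IsNbhd : Carrier → Subset Carrier → Set₁
  IsNbhd z V = Σ (Subset Carrier) λ S → (- S) z × (∀ y → (- S) y → V y)

  -- a countable base of neighbourhoods of z (indexed by ℕ; index k stands for k+1)
  IsCountableBase : Carrier → (ℕ → Subset Carrier) → Set₁
  IsCountableBase z V =
    (∀ n → IsNbhd z (V n)) ×
    (∀ W → IsNbhd z W → Σ ℕ λ n → ∀ y → V n y → W y)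

record DirectedSet : Set₁ where
  infix 4 _≽_
  field
    Index    : Set
    _≽_      : Index → Index → Set
    ≽-refl   : ∀ {a} → a ≽ a
    ≽-trans  : ∀ {a b c} → a ≽ b → b ≽ c → a ≽ c
    inhabited : Index
    directed : ∀ a b → Σ Index λ c → (c ≽ a) × (c ≽ b)

-- The positive integers (represented by ℕ, k ↦ k+1) with their usual order.
ℕ-directed : DirectedSet
ℕ-directed = record
  { Index = ℕ ; _≽_ = _≥_ ; ≽-refl = ≤-refl
  ; ≽-trans = λ p q → ≤-trans q p ; inhabited = 0
  ; directed = λ a b → a ⊔ b , m≤m⊔n a b , m≤n⊔m a b }

module _ (X : ApartnessSpace) where
  open ApartnessSpace X

  ConvergesTo : (D : DirectedSet) → (DirectedSet.Index D → Carrier) → Carrier → Set₁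
  ConvergesTo D x z =
    ∀ V → IsNbhd z V → Σ Index λ N → ∀ n → n ≽ N → V (x n)
    where open DirectedSet D

  -- a countable subnet (z_{n_k})_{k ≥ 1} is given by indices n_k with n_{k+1} ≽ n_k
  IsCountableSubnetIndex : (D : DirectedSet) → (ℕ → DirectedSet.Index D) → Set
  IsCountableSubnetIndex D nk = ∀ k → nk (Data.Nat.suc k) ≽ nk k
    where open DirectedSet D

module Submission where

-- The proof splits into two independent facts.
--   * Order theory: in any directed set, every sequence of indices
--     (N k) is dominated by an increasing sequence (n k), built by
--     recursion with n (k+1) an upper bound of n k and N (k+1); then
--     n j ≽ N k whenever j ≥ k.
--   * Topology: a sequence that lies eventually in each basic
--     neighbourhood V k converges to z, because every neighbourhood
--     of z contains some V k.
-- For the theorem, take N k to be a stage beyond which the net stays in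
-- V k.  The dominating sequence n then indexes a countable subnet, and
-- the subnet lies in V k from index k onwards, so it converges to z.

open import Defs
open import Data.Nat using (ℕ; zero; suc; _≤_; s≤s)
open import Data.Nat.Properties using (m≤n⇒m<n∨m≡n)
open import Data.Product using (Σ; _×_; _,_; proj₁; proj₂)
open import Data.Sum using (inj₁; inj₂)
open import Relation.Binary.PropositionalEquality using (refl)

module _ (D : DirectedSet) where
  open DirectedSet D

  dominating : (ℕ → Index) → ℕ → Index
  dominating N zero    = N zero
  dominating N (suc k) = proj₁ (directed (dominating N k) (N (suc k)))

  dominating-increasing : ∀ N → ∀ k → dominating N (suc k) ≽ dominating N k
  dominating-increasing N k = proj₁ (proj₂ (directed (dominating N k) (N (suc k))))

  dominating-above : ∀ N → ∀ k → dominating N k ≽ N k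
  dominating-above N zero    = ≽-refl
  dominating-above N (suc k) = proj₂ (proj₂ (directed (dominating N k) (N (suc k))))

  dominating-eventually-above : ∀ N → ∀ k j → k ≤ j → dominating N j ≽ N k
  dominating-eventually-above N k j k≤j with m≤n⇒m<n∨m≡n k≤j
  ... | inj₂ refl = dominating-above N k
  dominating-eventually-above N k (suc j) _ | inj₁ (s≤s k≤j) =
    ≽-trans (dominating-increasing N j) (dominating-eventually-above N k j k≤j)

module _ (X : ApartnessSpace) where
  open ApartnessSpace X

  converges-via-base : ∀ {z V} → IsCountableBase z V → (s : ℕ → Carrier) →
    (∀ k → Σ ℕ λ K → ∀ j → K ≤ j → V k (s j)) →
    ConvergesTo X ℕ-directed s z
  converges-via-base (_ , refines) s eventually W W-nbhd =
    let (k , Vk⊆W) = refines W W-nbhd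
        (K , tail) = eventually k
    in K , λ j K≤j → Vk⊆W (s j) (tail j K≤j)

lemma2p6 : (X : ApartnessSpace) (z : ApartnessSpace.Carrier X)
    (V : ℕ → Subset (ApartnessSpace.Carrier X)) →
    ApartnessSpace.IsCountableBase X z V →
    (D : DirectedSet) (x : DirectedSet.Index D → ApartnessSpace.Carrier X) →
    ConvergesTo X D x z →
    Σ (ℕ → DirectedSet.Index D) λ nk →
    IsCountableSubnetIndex X D nk × ConvergesTo X ℕ-directed (λ k → x (nk k)) z
lemma2p6 X z V base D x conv =
  dominating D N , dominating-increasing D N , converges-via-base X base _ in-Vk
  where
  N : ℕ → DirectedSet.Index D
  N k = proj₁ (conv (V k) (proj₁ base k))

  in-Vk : ∀ k → Σ ℕ λ K → ∀ j → K ≤ j → V k (x (dominating D N j))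
  in-Vk k = k , λ j k≤j →
    proj₂ (conv (V k) (proj₁ base k)) (dominating D N j)
          (dominating-eventually-above D N k j k≤j)
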